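{- For every fixed integer $k\ge1$, let $\mathcal{I}^k(n)$ denote the largest $k$-CF-chromatic number of a circle graph on $n$ vertices. Then $\mathcal{I}^k(n)=\Omega(\log n)$.
   Context: A circle graph is the intersection graph of a finite family of chords of a circle; equivalently, the overlap graph of a finite family of intervals on a line (two intervals adjacent iff they intersect but neither contains the other). For a graph $G=(V,E)$ and $v\in V$, $N_G(v)=\{u:\{u,v\}\in E\}$. A $k$-CF-coloring of $G$ is a map $c:V\to\mathbb{N}$ such that for every $v$ with $N_G(v)\ne\emptyset$ there is a color $i$ with $1\le|N_G(v)\cap c^{ -1}(i)|\le k$; the $k$-CF-chromatic number is the minimum number of colors in such a coloring. -}

module Defs where

open import Data.Nat using (ℕ; zero; suc; _≤ᵇ_; _≤_; _*_)
open import Data.Bool using (Bool; true; false; _∧_; not; T)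
open import Data.Fin using (Fin)
open import Data.List using (List; []; _∷_)
open import Data.Fin.Properties using () renaming (_≟_ to _≟F_)
open import Data.List using (allFin)
open import Data.Product using (Σ; ∃-syntax; _×_)
open import Relation.Nullary.Decidable using (⌊_⌋)

-- An interval model on vertex set Fin n: vertex i is the closed interval [ l i , r i ].
-- Closed intervals i and j intersect.
intersectsᵇ : ∀ {n} → (Fin n → ℕ) → (Fin n → ℕ) → Fin n → Fin n → Bool
intersectsᵇ l r i j = (l i ≤ᵇ r j) ∧ (l j ≤ᵇ r i)

containsᵇ : ∀ {n} → (Fin n → ℕ) → (Fin n → ℕ) → Fin n → Fin n → Bool
containsᵇ l r i j = (l i ≤ᵇ l j) ∧ (r j ≤ᵇ r i)

-- Overlap graph: adjacent iff the intervals intersect but neither contains the other.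
-- (Irreflexive automatically, since every interval contains itself.)
overlapᵇ : ∀ {n} → (Fin n → ℕ) → (Fin n → ℕ) → Fin n → Fin n → Bool
overlapᵇ l r i j =
  intersectsᵇ l r i j ∧ (not (containsᵇ l r i j) ∧ not (containsᵇ l r j i))

countᵇ : {A : Set} → (A → Bool) → List A → ℕ
countᵇ p [] = 0
countᵇ p (x ∷ xs) with p x
... | true  = suc (countᵇ p xs)
... | false = countᵇ p xs

nbrsOfColour : ∀ {n m} → (Fin n → ℕ) → (Fin n → ℕ) → (Fin n → Fin m) → Fin n → Fin m → ℕ
nbrsOfColour {n} l r c v i =
  countᵇ (λ u → overlapᵇ l r v u ∧ ⌊ c u ≟F i ⌋) (allFin n)

IsKCFColouring : ∀ {n m} → ℕ → (Fin n → ℕ) → (Fin n → ℕ) → (Fin n → Fin m) → Set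
IsKCFColouring {n} {m} k l r c =
  ∀ (v : Fin n) → (∃[ u ] T (overlapᵇ l r v u)) →
    ∃[ i ] (1 ≤ nbrsOfColour l r c v i × nbrsOfColour l r c v i ≤ k)

-- Let B = k + 1 and P = B ^ h.  The overlap graph consists of P "points", unit-spaced
-- intervals of length about P, and one "hub" interval for every block [a , a + B ^ j)
-- with 1 ≤ j ≤ h that is aligned (B ^ j ∣ a).  Hubs are laminar, so they never overlap
-- each other, and a hub overlaps exactly the points of its block.  In a k-CF-colouring
-- the hub of a block sees some colour i between 1 and k times, so i is absent from one
-- of the B sub-blocks; by induction on j every aligned block of size B ^ j carries
-- j + 1 distinct colours, and the whole range [0 , P) forces h + 1 colours.  The graph
-- has (h + 1) P vertices, which fits into n once h = ⌊log₂ n⌋ / B.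
module Submission where

open import Defs
open import Data.Bool using (Bool; true; false; _∧_; not; T)
open import Data.Bool.Properties using (T-∧; T-≡)
open import Data.Empty using (⊥-elim)
open import Data.Fin using (Fin; zero; suc; toℕ; fromℕ<)
open import Data.Fin.Properties using (toℕ-fromℕ<; toℕ-injective; toℕ<n; any?; all?; ¬∀⟶∃¬; injective⇒≤)
  renaming (_≟_ to _≟F_)
open import Data.List using ([]; _∷_; allFin; length; lookup; filterᵇ)
open import Data.List.Membership.Propositional using (_∈_)
open import Data.List.Membership.Propositional.Properties using (∈-allFin; ∈-filter⁺)
open import Data.List.Relation.Unary.Any using (index)
open import Data.List.Relation.Unary.Any.Properties using (lookup-index)
open import Data.Nat
open import Data.Nat.Properties
open import Data.Nat.Divisibility using (_∣_; divides; ∣-trans; n∣m*n; m∣m*n; ∣m∣n⇒∣m+n; _∣0)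
open import Data.Nat.DivMod
open import Data.Nat.Induction using (<-rec)
open import Data.Nat.Logarithm using (⌊log₂_⌋; ⌊log₂⌋-mono-≤; ⌊log₂⌊n/2⌋⌋≡⌊log₂n⌋∸1)
open import Data.Product using (Σ; ∃-syntax; _×_; _,_; proj₁; proj₂)
open import Data.Product.Function.NonDependent.Propositional using (_×-⇔_)
open import Data.Sum using (_⊎_; inj₁; inj₂)
open import Data.Vec.Functional using () renaming (_∷_ to _∷ᵛ_)
open import Function.Base using (_∘_)
open import Function.Bundles using (_⇔_; mk⇔; Equivalence)
open import Function.Construct.Composition using (_⇔-∘_)
open import Function.Definitions using (Injective)
open import Relation.Binary.PropositionalEquality
open import Relation.Binary.Definitions using (tri<; tri≈; tri>)
open import Relation.Nullary using (¬_; Dec; yes; no)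
open import Relation.Nullary.Decidable using (⌊_⌋; toWitness; fromWitness; T?; _×-dec_)

open Equivalence using (to; from)

Interval : Set
Interval = ℕ × ℕ

lo hi : Interval → ℕ
lo = proj₁
hi = proj₂

Meet : Interval → Interval → Set
Meet I J = lo I ≤ hi J × lo J ≤ hi I

Contains : Interval → Interval → Set
Contains I J = lo I ≤ lo J × hi J ≤ hi I

Overlap : Interval → Interval → Set
Overlap I J = Meet I J × (¬ Contains I J × ¬ Contains J I)

T-≤ᵇ : ∀ {m n} → T (m ≤ᵇ n) ⇔ m ≤ n
T-≤ᵇ = mk⇔ (≤ᵇ⇒≤ _ _) ≤⇒≤ᵇ

T-not : ∀ {b} → T (not b) ⇔ (¬ T b)
T-not {true}  = mk⇔ (λ ()) (λ ¬t → ¬t _)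
T-not {false} = mk⇔ (λ _ ()) (λ _ → _)

¬-⇔ : ∀ {A B : Set} → A ⇔ B → (¬ A) ⇔ (¬ B)
¬-⇔ A⇔B = mk⇔ (λ ¬a b → ¬a (from A⇔B b)) (λ ¬b a → ¬b (to A⇔B a))

module _ {n : ℕ} (l r : Fin n → ℕ) where

  private
    iv : Fin n → Interval
    iv u = l u , r u

  T-meet : ∀ i j → T (intersectsᵇ l r i j) ⇔ Meet (iv i) (iv j)
  T-meet i j = (T-≤ᵇ ×-⇔ T-≤ᵇ) ⇔-∘ T-∧

  T-not-contains : ∀ i j → T (not (containsᵇ l r i j)) ⇔ (¬ Contains (iv i) (iv j))
  T-not-contains i j = ¬-⇔ ((T-≤ᵇ ×-⇔ T-≤ᵇ) ⇔-∘ T-∧) ⇔-∘ T-not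

  T-overlap : ∀ i j → T (overlapᵇ l r i j) ⇔ Overlap (iv i) (iv j)
  T-overlap i j =
    (T-meet i j ×-⇔ ((T-not-contains i j ×-⇔ T-not-contains j i) ⇔-∘ T-∧)) ⇔-∘ T-∧

module _ {A : Set} (p : A → Bool) where

  countᵇ≡length-filterᵇ : ∀ xs → countᵇ p xs ≡ length (filterᵇ p xs)
  countᵇ≡length-filterᵇ []       = refl
  countᵇ≡length-filterᵇ (x ∷ xs) with p x
  ... | true  = cong suc (countᵇ≡length-filterᵇ xs)
  ... | false = countᵇ≡length-filterᵇ xs

  countᵇ-witness : ∀ xs → 1 ≤ countᵇ p xs → ∃[ x ] T (p x)
  countᵇ-witness (x ∷ xs) pos with p x in px
  ... | true  = x , from T-≡ px
  ... | false = countᵇ-witness xs pos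

  -- s distinct members of xs satisfying p show that countᵇ p xs is at least s:
  -- their positions in the filtered list are distinct.
  injection≤countᵇ : ∀ {s} xs (g : Fin s → A) → Injective _≡_ _≡_ g →
                     (∀ t → g t ∈ xs) → (∀ t → T (p (g t))) → s ≤ countᵇ p xs
  injection≤countᵇ {s} xs g g-injective g∈xs g-sat =
    subst (s ≤_) (sym (countᵇ≡length-filterᵇ xs)) (injective⇒≤ position-injective)
    where
    kept = filterᵇ p xs

    position : Fin s → Fin (length kept)
    position t = index (∈-filter⁺ (T? ∘ p) (g∈xs t) (g-sat t))

    position-injective : Injective _≡_ _≡_ position
    position-injective {t} {t′} same = g-injective (begin
      g t                     ≡⟨ lookup-index (∈-filter⁺ (T? ∘ p) (g∈xs t) (g-sat t)) ⟩
      lookup kept (position t)  ≡⟨ cong (lookup kept) same ⟩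
      lookup kept (position t′) ≡⟨ lookup-index (∈-filter⁺ (T? ∘ p) (g∈xs t′) (g-sat t′)) ⟨
      g t′                    ∎)
      where open ≡-Reasoning

even≤even : ∀ {m n} → 2 * m ≤ 2 * n ⇔ m ≤ n
even≤even = mk⇔ (*-cancelˡ-≤ 2) (*-monoʳ-≤ 2)

odd≤even : ∀ {m n} → suc (2 * m) ≤ 2 * n ⇔ m < n
odd≤even {m} {n} = mk⇔ (*-cancelˡ-< 2 m n)
  (λ m<n → ≤-trans (n≤1+n _) (≤-trans (≤-reflexive (sym (*-suc 2 m))) (*-monoʳ-≤ 2 m<n)))

even≤odd : ∀ {m n} → 2 * m ≤ suc (2 * n) ⇔ m ≤ n
even≤odd {m} {n} = mk⇔
  (λ 2m≤ → ≤-pred (*-cancelˡ-< 2 m (suc n)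
     (≤-trans (s≤s 2m≤) (≤-reflexive (sym (*-suc 2 n))))))
  (λ m≤n → m≤n⇒m≤1+n (*-monoʳ-≤ 2 m≤n))

∣-gap : ∀ {S x y} → S ∣ x → S ∣ y → x < y → x + S ≤ y
∣-gap {S} (divides p refl) (divides q refl) x<y =
  subst (_≤ q * S) (+-comm S (p * S)) (*-monoˡ-≤ S (*-cancelʳ-< S p q x<y))

stripe-before : ∀ a s {t t′} → t < t′ → a + t * s + s ≤ a + t′ * s
stripe-before a s {t} {t′} t<t′ = begin
  a + t * s + s    ≡⟨ +-assoc a (t * s) s ⟩
  a + (t * s + s)  ≡⟨ cong (a +_) (+-comm (t * s) s) ⟩
  a + suc t * s    ≤⟨ +-monoʳ-≤ a (*-monoˡ-≤ s t<t′) ⟩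
  a + t′ * s       ∎
  where open ≤-Reasoning

stripes-disjoint : ∀ a s {t t′ x} → a + t * s ≤ x → x < a + t * s + s →
                   a + t′ * s ≤ x → x < a + t′ * s + s → t ≡ t′
stripes-disjoint a s {t} {t′} start≤x x<end start′≤x x<end′ with <-cmp t t′
... | tri< t<t′ _ _ = ⊥-elim (<⇒≱ x<end (≤-trans (stripe-before a s t<t′) start′≤x))
... | tri≈ _ t≡t′ _ = t≡t′
... | tri> _ _ t′<t = ⊥-elim (<⇒≱ x<end′ (≤-trans (stripe-before a s t′<t) start≤x))

aligned-blocks : ∀ {S S′ a a′} → S ∣ S′ → S ∣ a → S′ ∣ a′ →
  a + S ≤ a′ ⊎ a′ + S′ ≤ a ⊎ (a′ ≤ a × a + S ≤ a′ + S′)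
aligned-blocks {S} {S′} {a} {a′} S∣S′ S∣a S′∣a′ with a′ + S′ ≤? a | a + S ≤? a′
... | yes after  | _          = inj₂ (inj₁ after)
... | no _       | yes before = inj₁ before
... | no ¬after  | no ¬before = inj₂ (inj₂ (a′≤a , ∣-gap S∣a S∣a′+S′ (≰⇒> ¬after)))
  where
  S∣a′ = ∣-trans S∣S′ S′∣a′
  S∣a′+S′ = ∣m∣n⇒∣m+n S∣a′ S∣S′
  a′≤a : a′ ≤ a
  a′≤a = ≮⇒≥ (λ a<a′ → ¬before (∣-gap S∣a S∣a′ a<a′))

^-∣ : ∀ B {i j} → i ≤ j → B ^ i ∣ B ^ j
^-∣ B {i} {j} i≤j with d , refl ← m≤n⇒∃[o]m+o≡n i≤j =
  subst (B ^ i ∣_) (sym (^-distribˡ-+-* B i d)) (m∣m*n (B ^ d))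

1+n≤2^n : ∀ n → suc n ≤ 2 ^ n
1+n≤2^n zero    = ≤-refl
1+n≤2^n (suc n) = begin
  suc (suc n)     ≤⟨ s≤s (1+n≤2^n n) ⟩
  suc (2 ^ n)     ≤⟨ +-monoˡ-≤ (2 ^ n) (m^n>0 2 n) ⟩
  2 ^ n + 2 ^ n   ≡⟨ cong (2 ^ n +_) (+-identityʳ (2 ^ n)) ⟨
  2 * 2 ^ n       ∎
  where open ≤-Reasoning

2^⌊log₂n⌋≤n : ∀ n → 1 ≤ n → 2 ^ ⌊log₂ n ⌋ ≤ n
2^⌊log₂n⌋≤n = <-rec _ step
  where
  step : ∀ n → (∀ {m} → m < n → 1 ≤ m → 2 ^ ⌊log₂ m ⌋ ≤ m) → 1 ≤ n → 2 ^ ⌊log₂ n ⌋ ≤ n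
  step (suc zero)          _   _ = ≤-refl
  step n@(suc (suc n-2)) rec _ = begin
    2 ^ ⌊log₂ n ⌋          ≡⟨ cong (2 ^_) log-halves ⟩
    2 * 2 ^ ⌊log₂ half ⌋   ≤⟨ *-monoʳ-≤ 2 (rec (⌊n/2⌋<n (suc n-2)) (s≤s z≤n)) ⟩
    half + (half + 0)      ≤⟨ +-monoʳ-≤ half (≤-trans (≤-reflexive (+-identityʳ half)) (⌊n/2⌋≤⌈n/2⌉ n)) ⟩
    half + ⌈ n /2⌉          ≡⟨ ⌊n/2⌋+⌈n/2⌉≡n n ⟩
    n                      ∎
    where
    open ≤-Reasoning
    half = ⌊ n /2⌋
    log-halves : ⌊log₂ n ⌋ ≡ suc ⌊log₂ half ⌋
    log-halves = begin-equality
      ⌊log₂ n ⌋            ≡⟨ m+[n∸m]≡n (⌊log₂⌋-mono-≤ {2} {n} (s≤s (s≤s z≤n))) ⟨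
      suc (⌊log₂ n ⌋ ∸ 1)  ≡⟨ cong suc (⌊log₂⌊n/2⌋⌋≡⌊log₂n⌋∸1 n) ⟨
      suc ⌊log₂ half ⌋     ∎

-- With h = ⌊log₂ n⌋ / B the construction below fits into n vertices:
-- (h + 1) B ^ h ≤ 2 ^ h (2 ^ (B - 1)) ^ h = 2 ^ (B h) ≤ 2 ^ ⌊log₂ n⌋ ≤ n.
construction-fits : ∀ k n → 1 ≤ n →
  let h = ⌊log₂ n ⌋ / suc k in suc h * suc k ^ h ≤ n
construction-fits k n 1≤n = begin
  suc h * suc k ^ h       ≤⟨ *-mono-≤ (1+n≤2^n h) (^-monoˡ-≤ h (1+n≤2^n k)) ⟩
  2 ^ h * (2 ^ k) ^ h     ≡⟨ cong (2 ^ h *_) (^-*-assoc 2 k h) ⟩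
  2 ^ h * 2 ^ (k * h)     ≡⟨ ^-distribˡ-+-* 2 h (k * h) ⟨
  2 ^ (suc k * h)         ≤⟨ ^-monoʳ-≤ 2 (subst (_≤ L) (*-comm h (suc k)) (m/n*n≤m L (suc k))) ⟩
  2 ^ L                   ≤⟨ 2^⌊log₂n⌋≤n n 1≤n ⟩
  n                       ∎
  where
  open ≤-Reasoning
  L = ⌊log₂ n ⌋
  h = L / suc k

m<n*[1+m/n] : ∀ m n .{{_ : NonZero n}} → m < n * suc (m / n)
m<n*[1+m/n] m n = begin-strict
  m                  ≡⟨ m≡m%n+[m/n]*n m n ⟩
  m % n + m / n * n  <⟨ +-monoˡ-< (m / n * n) (m%n<n m n) ⟩
  n + m / n * n      ≡⟨ cong (n +_) (*-comm (m / n) n) ⟩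
  n + n * (m / n)    ≡⟨ *-suc n (m / n) ⟨
  n * suc (m / n)    ∎
  where open ≤-Reasoning

-- The hub of the block [a , a + S): odd left end, even right end.
hubIv : ℕ → ℕ → Interval
hubIv a S = suc (2 * a) , 2 * (a + S)

-- The point x: an interval of length 2Q starting strictly inside every hub
-- whose block contains x.
pointIv : ℕ → ℕ → Interval
pointIv Q x = 2 * suc x , 2 * (suc x + Q)

Overlap-sym : ∀ {I J} → Overlap I J → Overlap J I
Overlap-sym ((I≤J , J≤I) , ¬I⊇J , ¬J⊇I) = (J≤I , I≤J) , ¬J⊇I , ¬I⊇J

hub-overlaps-point : ∀ {a S Q x} → a + S ≤ x + Q →
  Overlap (hubIv a S) (pointIv Q x) ⇔ (a ≤ x × x < a + S)
hub-overlaps-point {a} {S} {Q} {x} reaches = mk⇔ inside overlaps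
  where
  inside : Overlap (hubIv a S) (pointIv Q x) → a ≤ x × x < a + S
  inside ((_ , x<end) , _ , ¬point⊇hub) = a≤x , to even≤even x<end
    where
    a≤x : a ≤ x
    a≤x = ≮⇒≥ (λ x<a → ¬point⊇hub (from even≤odd x<a , from even≤even (m≤n⇒m≤1+n reaches)))

  overlaps : a ≤ x × x < a + S → Overlap (hubIv a S) (pointIv Q x)
  overlaps (a≤x , x<end) =
    (from odd≤even (s≤s (≤-trans a≤x (m≤m+n x Q))) , from even≤even x<end) ,
    (λ (_ , ends) → 1+n≰n (≤-trans (to even≤even ends) reaches)) ,
    (λ (starts , _) → 1+n≰n (≤-trans (to even≤odd starts) a≤x))

separated-hubs : ∀ {a S a′ S′} → a + S ≤ a′ ⊎ a′ + S′ ≤ a ⊎ (a′ ≤ a × a + S ≤ a′ + S′) →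
  ¬ Overlap (hubIv a S) (hubIv a′ S′)
separated-hubs (inj₁ before)      ((_ , meets) , _) = 1+n≰n (≤-trans (to odd≤even meets) before)
separated-hubs (inj₂ (inj₁ after)) ((meets , _) , _) = 1+n≰n (≤-trans (to odd≤even meets) after)
separated-hubs (inj₂ (inj₂ (a′≤a , end≤end′))) (_ , _ , ¬outer⊇inner) =
  ¬outer⊇inner (s≤s (*-monoʳ-≤ 2 a′≤a) , from even≤even end≤end′)

aligned-hubs : ∀ B i i′ {a a′} → B ^ i ∣ a → B ^ i′ ∣ a′ →
  ¬ Overlap (hubIv a (B ^ i)) (hubIv a′ (B ^ i′))
aligned-hubs B i i′ B^i∣a B^i′∣a′ with ≤-total i i′
... | inj₁ i≤i′ = separated-hubs (aligned-blocks (^-∣ B i≤i′) B^i∣a B^i′∣a′)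
... | inj₂ i′≤i = separated-hubs (aligned-blocks (^-∣ B i′≤i) B^i′∣a′ B^i∣a) ∘ Overlap-sym

InBlock : ∀ {n} → ℕ → ℕ → Fin n → Set
InBlock a S u = a ≤ toℕ u × toℕ u < a + S

HubOf : ∀ {n} → (Fin n → ℕ) → (Fin n → ℕ) → Fin n → ℕ → ℕ → Set
HubOf l r w a S = ∀ u → T (overlapᵇ l r w u) ⇔ InBlock a S u

∷-injective : ∀ {A : Set} {j} {x : A} {f : Fin j → A} →
  Injective _≡_ _≡_ f → (∀ t → f t ≢ x) → Injective _≡_ _≡_ (x ∷ᵛ f)
∷-injective f-inj fresh {zero}  {zero}   _  = refl
∷-injective f-inj fresh {zero}  {suc t′} eq = ⊥-elim (fresh t′ (sym eq))
∷-injective f-inj fresh {suc t} {zero}   eq = ⊥-elim (fresh t eq)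
∷-injective f-inj fresh {suc t} {suc t′} eq = cong suc (f-inj eq)

module ColourBound {n m : ℕ} (k h : ℕ) (l r : Fin n → ℕ) (c : Fin n → Fin m)
  (cf : IsKCFColouring k l r c) (points : suc k ^ h ≤ n)
  (hub : ∀ j a → suc j ≤ h → suc k ^ suc j ∣ a → a + suc k ^ suc j ≤ suc k ^ h →
         ∃[ w ] HubOf l r w a (suc k ^ suc j))
  where

  B P : ℕ
  B = suc k
  P = B ^ h

  Occurs : Fin m → ℕ → ℕ → Set
  Occurs i a S = ∃[ u ] InBlock a S u × c u ≡ i

  occurs? : ∀ i a S → Dec (Occurs i a S)
  occurs? i a S = any? (λ u → (a ≤? toℕ u ×-dec toℕ u <? a + S) ×-dec (c u ≟F i))

  Rainbow : ℕ → ℕ → Set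
  Rainbow j a = Σ (Fin (suc j) → Fin m) λ f → Injective _≡_ _≡_ f × (∀ t → Occurs (f t) a (B ^ j))

  point : ∀ {a} → a < P → Fin n
  point a<P = fromℕ< (<-≤-trans a<P points)

  point-in-block : ∀ {a S} (a<P : a < P) → 0 < S → InBlock a S (point a<P)
  point-in-block {a} a<P S>0 rewrite toℕ-fromℕ< (<-≤-trans a<P points) = ≤-refl , m<m+n a S>0

  subblock-⊆ : ∀ {a s} (t : Fin B) {u : Fin n} → InBlock (a + toℕ t * s) s u → InBlock a (B * s) u
  subblock-⊆ {a} {s} t (start≤ , <end) =
    ≤-trans (m≤m+n a _) start≤ , <-≤-trans <end (stripe-before a s (toℕ<n t))

  rare-colour-occurs : ∀ {w a S i} → HubOf l r w a S → 1 ≤ nbrsOfColour l r c w i → Occurs i a S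
  rare-colour-occurs {w} {i = i} w-hub present =
    let u , seen = countᵇ-witness (λ u → overlapᵇ l r w u ∧ ⌊ c u ≟F i ⌋) (allFin n) present
        adjacent , coloured = to T-∧ seen
    in u , to (w-hub u) adjacent , toWitness coloured

  every-subblock⇒B≤count : ∀ {w a s i} → HubOf l r w a (B * s) →
    (∀ t → Occurs i (a + toℕ t * s) s) → B ≤ nbrsOfColour l r c w i
  every-subblock⇒B≤count {w} {a} {s} {i} w-hub occ =
    injection≤countᵇ _ (allFin n) (proj₁ ∘ occ) distinct (∈-allFin ∘ proj₁ ∘ occ) seen
    where
    distinct : Injective _≡_ _≡_ (proj₁ ∘ occ)
    distinct {t} {t′} same =
      let start≤ , <end = proj₁ (proj₂ (occ t))
          start′≤ , <end′ = proj₁ (proj₂ (occ t′))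
      in toℕ-injective (stripes-disjoint a s start≤ <end
           (subst (λ u → a + toℕ t′ * s ≤ toℕ u) (sym same) start′≤)
           (subst (λ u → toℕ u < a + toℕ t′ * s + s) (sym same) <end′))

    seen : ∀ t → T (overlapᵇ l r w (proj₁ (occ t)) ∧ ⌊ c (proj₁ (occ t)) ≟F i ⌋)
    seen t = let u , in-subblock , coloured = occ t
             in from T-∧ (from (w-hub u) (subblock-⊆ t in-subblock) , fromWitness coloured)

  -- Hence a colour seen at most k < B times by the hub is missing from some sub-block.
  rare-colour-missing : ∀ {w a s i} → HubOf l r w a (B * s) → nbrsOfColour l r c w i ≤ k →
    ∃[ t ] ¬ Occurs i (a + toℕ t * s) s
  rare-colour-missing {a = a} {s} {i} w-hub rare with all? (λ t → occurs? i (a + toℕ t * s) s)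
  ... | yes everywhere = ⊥-elim (1+n≰n (≤-trans (every-subblock⇒B≤count w-hub everywhere) rare))
  ... | no ¬everywhere = ¬∀⟶∃¬ B _ (λ t → occurs? i (a + toℕ t * s) s) ¬everywhere

  rainbow : ∀ j a → j ≤ h → B ^ j ∣ a → a + B ^ j ≤ P → Rainbow j a
  rainbow zero a _ _ end≤P =
    (λ _ → c (point a<P)) , (λ { {zero} {zero} _ → refl }) ,
    (λ _ → point a<P , point-in-block a<P ≤-refl , refl)
    where
    a<P = subst (_≤ P) (+-comm a 1) end≤P
  rainbow (suc j) a j<h S∣a end≤P =
    let w , w-hub          = hub j a j<h S∣a end≤P
        i , present , rare = cf w (point a<P , from (w-hub _) (point-in-block a<P S>0))
        t , absent         = rare-colour-missing w-hub rare
        f , f-inj , f-occ  = rainbow j (a + toℕ t * s) (<⇒≤ j<h)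
                               (∣m∣n⇒∣m+n (∣-trans (n∣m*n B) S∣a) (n∣m*n (toℕ t)))
                               (≤-trans (stripe-before a s (toℕ<n t)) end≤P)
    in (i ∷ᵛ f) ,
       ∷-injective f-inj (λ t′ f-t′≡i → absent (subst (λ i → Occurs i _ s) f-t′≡i (f-occ t′))) ,
       λ { zero → rare-colour-occurs w-hub present
         ; (suc t′) → let u , in-subblock , coloured = f-occ t′
                      in u , subblock-⊆ t in-subblock , coloured }
    where
    s = B ^ j
    S>0 = m^n>0 B (suc j)
    a<P = <-≤-trans (m<m+n a S>0) end≤P

  colour-bound : suc h ≤ m
  colour-bound = injective⇒≤ (proj₁ (proj₂ (rainbow h 0 ≤-refl (P ∣0) ≤-refl)))

-- With P = B ^ h, vertex x < P is the point x, and vertex x ≥ P is the hub of the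
-- block of size B ^ (x / P), aligned to its size, that contains x % P.
module Construction (B : ℕ) .{{_ : NonZero B}} (h : ℕ) where

  P : ℕ
  P = B ^ h

  instance
    P-nonZero : NonZero P
    P-nonZero = m^n≢0 B h

  round : ℕ → ℕ → ℕ
  round q e = _/_ q (B ^ e) {{m^n≢0 B e}} * B ^ e

  round-aligned : ∀ {q} e → B ^ e ∣ q → round q e ≡ q
  round-aligned e = m/n*n≡m {{m^n≢0 B e}}

  round-divisible : ∀ q e → B ^ e ∣ round q e
  round-divisible q e = n∣m*n (_/_ q (B ^ e) {{m^n≢0 B e}})

  size start : ℕ → ℕ
  size x  = B ^ (x / P)
  start x = round (x % P) (x / P)

  interval : ℕ → Interval
  interval x with x <? P
  ... | yes _ = pointIv P x
  ... | no _  = hubIv (start x) (size x)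

  interval-proper : ∀ x → lo (interval x) ≤ hi (interval x)
  interval-proper x with x <? P
  ... | yes _ = *-monoʳ-≤ 2 (m≤m+n (suc x) P)
  ... | no _  = from odd≤even (m<m+n (start x) (m^n>0 B (x / P)))

  -- A hub of an aligned block inside [0 , P) overlaps exactly the points of its block;
  -- it overlaps no other hub, as all hub blocks are aligned.
  hub-sees : ∀ {j a} → B ^ j ∣ a → a + B ^ j ≤ P →
    ∀ y → Overlap (hubIv a (B ^ j)) (interval y) ⇔ (a ≤ y × y < a + B ^ j)
  hub-sees {j} aligned end≤P y with y <? P
  ... | yes _   = hub-overlaps-point (≤-trans end≤P (m≤n+m P y))
  ... | no y≮P = mk⇔ (⊥-elim ∘ aligned-hubs B j (y / P) aligned (round-divisible (y % P) (y / P)))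
                     (λ (_ , y<end) → ⊥-elim (y≮P (<-≤-trans y<end end≤P)))

  hub-interval : ∀ j {a} → a < P → B ^ suc j ∣ a → interval (a + suc j * P) ≡ hubIv a (B ^ suc j)
  hub-interval j {a} a<P aligned with (a + suc j * P) <? P
  ... | yes x<P = ⊥-elim (<⇒≱ x<P (≤-trans (m≤m+n P (j * P)) (m≤n+m _ a)))
  ... | no _    = cong₂ hubIv start≡a (cong (B ^_) level≡)
    where
    x = a + suc j * P

    level≡ : x / P ≡ suc j
    level≡ = begin
      x / P                      ≡⟨ +-distrib-/-∣ʳ a {d = P} (n∣m*n (suc j)) ⟩
      a / P + suc j * P / P      ≡⟨ cong₂ _+_ (m<n⇒m/n≡0 a<P) (m*n/n≡m (suc j) P) ⟩
      suc j                      ∎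
      where open ≡-Reasoning

    start≡a : start x ≡ a
    start≡a = begin
      round (x % P) (x / P)  ≡⟨ cong (round (x % P)) level≡ ⟩
      round (x % P) (suc j)  ≡⟨ cong (λ o → round o (suc j)) ([m+kn]%n≡m%n a (suc j) P) ⟩
      round (a % P) (suc j)  ≡⟨ cong (λ o → round o (suc j)) (m<n⇒m%n≡m a<P) ⟩
      round a (suc j)        ≡⟨ round-aligned (suc j) aligned ⟩
      a                      ∎
      where open ≡-Reasoning

  module Graph (n : ℕ) (fits : suc h * P ≤ n) where

    l r : Fin n → ℕ
    l u = lo (interval (toℕ u))
    r u = hi (interval (toℕ u))

    points : P ≤ n
    points = ≤-trans (m≤m+n P (h * P)) fits

    hub-exists : ∀ j a → suc j ≤ h → B ^ suc j ∣ a → a + B ^ suc j ≤ P →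
      ∃[ w ] HubOf l r w a (B ^ suc j)
    hub-exists j a j<h aligned end≤P = w , sees
      where
      a<P = <-≤-trans (m<m+n a (m^n>0 B (suc j))) end≤P
      x<n : a + suc j * P < n
      x<n = <-≤-trans (+-monoˡ-< (suc j * P) a<P) (≤-trans (*-monoˡ-≤ P (s≤s j<h)) fits)
      w = fromℕ< x<n

      w-interval : interval (toℕ w) ≡ hubIv a (B ^ suc j)
      w-interval = trans (cong interval (toℕ-fromℕ< x<n)) (hub-interval j a<P aligned)

      sees : HubOf l r w a (B ^ suc j)
      sees u = subst (λ I → Overlap I (interval (toℕ u)) ⇔ InBlock a (B ^ suc j) u) (sym w-interval)
                 (hub-sees {suc j} aligned end≤P (toℕ u))
               ⇔-∘ T-overlap l r w u

lemma3 : ∀ (k : ℕ) → 1 ≤ k →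
    ∃[ C ] ∃[ N ] ∀ (n : ℕ) → N ≤ n →
      Σ (Fin n → ℕ) λ l → Σ (Fin n → ℕ) λ r →
        (∀ i → l i ≤ r i) ×
        (∀ (m : ℕ) (c : Fin n → Fin m) → IsKCFColouring k l r c → ⌊log₂ n ⌋ ≤ C * m)
lemma3 k _ = suc k , 1 , λ n 1≤n →
  let h = ⌊log₂ n ⌋ / suc k
      open Construction (suc k) h
      open Graph n (construction-fits k n 1≤n)
  in l , r , (λ u → interval-proper (toℕ u)) , λ m c cf →
       let h<m = ColourBound.colour-bound k h l r c cf points hub-exists
       in ≤-trans (<⇒≤ (m<n*[1+m/n] ⌊log₂ n ⌋ (suc k))) (*-monoʳ-≤ (suc k) h<m)
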